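{- Let $k\ge1$. The following two sets are equal: (1) the set of all ordered pairs $(\sigma,\tau)$ of vertex-disjoint $k$-faces of $[3]^{*k+1}$; (2) the mod 2 sum (iterated symmetric difference) of the products $P\times Q$ over all ordered pairs $(P,Q)$ of $k$-octahedra from $[3]^{*k+1}$ whose intersection is $1^{*k+1}$.
   Context: $[3]^{*k+1}$ is the $k$-complex with vertex set $[k+1]\times[3]$ whose $k$-faces are $\sigma=\sigma_1*\dots*\sigma_{k+1}$, spanned by $(1,\sigma_1),\dots,(k+1,\sigma_{k+1})$, $\sigma_i\in[3]$; two $k$-faces are vertex-disjoint if $\sigma_i\ne\tau_i$ for all $i$. A $k$-octahedron $P=P_1*\dots*P_{k+1}$ ($P_i\subset[3]$ 2-element subsets) is the set of $k$-faces $\sigma$ with $\sigma_i\in P_i$ for all $i$; its intersection with $Q$ is $1^{*k+1}$ means $P_i\cap Q_i=\{1\}$ for all $i$. $P\times Q$ is the set of ordered pairs $(\alpha,\beta)$ of $k$-faces with $\alpha\in P$, $\beta\in Q$. -}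

module Defs where

open import Data.Nat using (ℕ; zero; suc)
open import Data.Nat.Properties using () renaming (_≟_ to _≟ℕ_)
open import Data.Bool using (Bool; true; false; not; _∧_; _xor_) renaming (_≟_ to _≟B_)
open import Data.Fin using (Fin) renaming (_≟_ to _≟F_)
open import Data.Fin.Subset using (Subset; _∩_; ⁅_⁆; ∣_∣)
open import Data.Vec using (Vec; []; _∷_; lookup)
open import Data.Vec.Properties using (≡-dec)
open import Data.List using (List; []; _∷_; map; concatMap; filter; foldr; cartesianProduct)
open import Data.Product using (_×_; _,_; proj₁; proj₂)
open import Relation.Nullary.Decidable using (⌊_⌋)

-- Conventions: [3] = Fin 3, with the paper's vertex 1 being  Fin.zero .
-- The index set [k+1] is Fin (suc k).

-- A k-face σ = σ_1 * … * σ_{k+1} of [3]^{*k+1}: a vector (σ_1,…,σ_{k+1}).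
Face : ℕ → Set
Face k = Vec (Fin 3) (suc k)

allVecs : {A : Set} → List A → (n : ℕ) → List (Vec A n)
allVecs xs zero    = [] ∷ []
allVecs xs (suc n) = concatMap (λ x → map (x ∷_) (allVecs xs n)) xs

allSubsets3 : List (Subset 3)
allSubsets3 = allVecs (true ∷ false ∷ []) 3

twoSubsets : List (Subset 3)
twoSubsets = filter (λ s → ∣ s ∣ ≟ℕ 2) allSubsets3

-- A k-octahedron P = P_1 * … * P_{k+1}, each P_i a 2-element subset of [3].
-- (Octahedra are always drawn from the list allOctahedra below.)
Octahedron : ℕ → Set
Octahedron k = Vec (Subset 3) (suc k)

allOctahedra : (k : ℕ) → List (Octahedron k)
allOctahedra k = allVecs twoSubsets (suc k)

allZip : {A B : Set} {n : ℕ} → (A → B → Bool) → Vec A n → Vec B n → Bool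
allZip R []       []       = true
allZip R (a ∷ as) (b ∷ bs) = R a b ∧ allZip R as bs

faceIn : {k : ℕ} → Face k → Octahedron k → Bool
faceIn σ P = allZip (λ s p → lookup p s) σ P

vertexDisjoint : {k : ℕ} → Face k → Face k → Bool
vertexDisjoint σ τ = allZip (λ a b → not ⌊ a ≟F b ⌋) σ τ

intersectionIsOne : {k : ℕ} → Octahedron k → Octahedron k → Bool
intersectionIsOne P Q =
  allZip (λ p q → ⌊ ≡-dec _≟B_ (p ∩ q) ⁅ Fin.zero ⁆ ⌋) P Q

admissiblePairs : (k : ℕ) → List (Octahedron k × Octahedron k)
admissiblePairs k =
  filter (λ PQ → intersectionIsOne (proj₁ PQ) (proj₂ PQ) ≟B true)
         (cartesianProduct (allOctahedra k) (allOctahedra k))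

product : {k : ℕ} → Octahedron k × Octahedron k → Face k × Face k → Bool
product (P , Q) (α , β) = faceIn α P ∧ faceIn β Q

symDiffSum : {A : Set} → List (A → Bool) → A → Bool
symDiffSum Ss a = foldr (λ S acc → S a xor acc) false Ss

disjointPairs : (k : ℕ) → Face k × Face k → Bool
disjointPairs k (σ , τ) = vertexDisjoint σ τ

octahedralSum : (k : ℕ) → Face k × Face k → Bool
octahedralSum k = symDiffSum (map product (admissiblePairs k))

-- Expanding the mod-2 sum, the value at (σ , τ) is the parity of the number of
-- pairs of octahedra (P , Q) with P ∩ Q = 1^{*k+1}, σ ∈ P and τ ∈ Q.  All three
-- conditions are coordinatewise, so this parity factors as a product over the
-- coordinates i of the parity of the number of pairs (p , q) of 2-subsets of [3]
-- with p ∩ q = {1}, σ_i ∈ p and τ_i ∈ q.  That count is 1 if σ_i ≠ τ_i, and 2 or 0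
-- if σ_i = τ_i (according as σ_i = 1 or not), so the product is odd exactly when σ
-- and τ are vertex-disjoint.
module Submission where

open import Defs
open import Algebra.Bundles using (CommutativeMonoid; CommutativeRing)
open import Data.Bool using (Bool; true; false; not; _∧_; _xor_) renaming (_≟_ to _≟B_)
open import Data.Bool.Properties
  using (∧-commutativeMonoid; xor-∧-commutativeRing; xor-assoc; ∧-distribˡ-xor; ∧-distribʳ-xor)
open import Data.Fin using (Fin) renaming (_≟_ to _≟F_)
open import Data.Fin.Subset using (Subset; _∩_; ⁅_⁆)
open import Data.List using (List; []; _∷_; map; concatMap; filter; foldr; cartesianProduct; _++_)
open import Data.Nat using (ℕ; suc; _≤_)
open import Data.Product using (_×_; _,_; proj₁; proj₂)
open import Data.Vec using (Vec; []; _∷_; lookup)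
open import Data.Vec.Properties using (≡-dec)
open import Relation.Binary.PropositionalEquality using (_≡_; refl; cong; cong₂; sym; trans; module ≡-Reasoning)
open import Relation.Nullary.Decidable using (⌊_⌋)

open import Algebra.Properties.CommutativeSemigroup
  (CommutativeRing.+-commutativeSemigroup xor-∧-commutativeRing)
  using () renaming (interchange to xor-interchange)
open import Algebra.Properties.CommutativeSemigroup
  (CommutativeMonoid.commutativeSemigroup ∧-commutativeMonoid)
  using () renaming (interchange to ∧-interchange)

private
  variable
    A B S T : Set
    n : ℕ

parity : List A → (A → Bool) → Bool
parity xs f = foldr (λ x acc → f x xor acc) false xs

parity-cong : (xs : List A) {f g : A → Bool} → (∀ x → f x ≡ g x) → parity xs f ≡ parity xs g
parity-cong []       f≡g = refl
parity-cong (x ∷ xs) f≡g = cong₂ _xor_ (f≡g x) (parity-cong xs f≡g)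

parity-false : (xs : List A) → parity xs (λ _ → false) ≡ false
parity-false []       = refl
parity-false (x ∷ xs) = parity-false xs

parity-map : (h : A → B) (xs : List A) (f : B → Bool) → parity (map h xs) f ≡ parity xs (λ x → f (h x))
parity-map h []       f = refl
parity-map h (x ∷ xs) f = cong (f (h x) xor_) (parity-map h xs f)

parity-++ : (xs ys : List A) (f : A → Bool) → parity (xs ++ ys) f ≡ parity xs f xor parity ys f
parity-++ []       ys f = refl
parity-++ (x ∷ xs) ys f =
  trans (cong (f x xor_) (parity-++ xs ys f)) (sym (xor-assoc (f x) (parity xs f) (parity ys f)))

parity-concatMap : (g : A → List B) (xs : List A) (f : B → Bool) →
                   parity (concatMap g xs) f ≡ parity xs (λ x → parity (g x) f)
parity-concatMap g []       f = refl
parity-concatMap g (x ∷ xs) f =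
  trans (parity-++ (g x) (concatMap g xs) f) (cong (parity (g x) f xor_) (parity-concatMap g xs f))

parity-cartesianProduct : (xs : List A) (ys : List B) (f : A × B → Bool) →
                          parity (cartesianProduct xs ys) f ≡ parity xs (λ x → parity ys (λ y → f (x , y)))
parity-cartesianProduct []       ys f = refl
parity-cartesianProduct (x ∷ xs) ys f =
  trans (parity-++ (map (x ,_) ys) (cartesianProduct xs ys) f)
        (cong₂ _xor_ (parity-map (x ,_) ys f) (parity-cartesianProduct xs ys f))

parity-filter : (p : A → Bool) (xs : List A) (f : A → Bool) →
                parity (filter (λ x → p x ≟B true) xs) f ≡ parity xs (λ x → p x ∧ f x)
parity-filter p []       f = refl
parity-filter p (x ∷ xs) f with p x
... | true  = cong (f x xor_) (parity-filter p xs f)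
... | false = parity-filter p xs f

parity-xor : (xs : List A) (f g : A → Bool) → parity xs (λ x → f x xor g x) ≡ parity xs f xor parity xs g
parity-xor []       f g = refl
parity-xor (x ∷ xs) f g =
  trans (cong ((f x xor g x) xor_) (parity-xor xs f g)) (xor-interchange (f x) (g x) (parity xs f) (parity xs g))

parity-∧ˡ : (xs : List A) (c : Bool) (f : A → Bool) → parity xs (λ x → c ∧ f x) ≡ c ∧ parity xs f
parity-∧ˡ []       false f = refl
parity-∧ˡ []       true  f = refl
parity-∧ˡ (x ∷ xs) c     f =
  trans (cong ((c ∧ f x) xor_) (parity-∧ˡ xs c f)) (sym (∧-distribˡ-xor c (f x) (parity xs f)))

parity-∧ʳ : (xs : List A) (f : A → Bool) (c : Bool) → parity xs (λ x → f x ∧ c) ≡ parity xs f ∧ c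
parity-∧ʳ []       f false = refl
parity-∧ʳ []       f true  = refl
parity-∧ʳ (x ∷ xs) f c     =
  trans (cong ((f x ∧ c) xor_) (parity-∧ʳ xs f c)) (sym (∧-distribʳ-xor c (f x) (parity xs f)))

parity-comm : (xs : List A) (ys : List B) (f : A → B → Bool) →
              parity xs (λ x → parity ys (f x)) ≡ parity ys (λ y → parity xs (λ x → f x y))
parity-comm []       ys f = sym (parity-false ys)
parity-comm (x ∷ xs) ys f =
  trans (cong (parity ys (f x) xor_) (parity-comm xs ys f))
        (sym (parity-xor ys (f x) (λ y → parity xs (λ x′ → f x′ y))))

parity-allVecs-suc : (xs : List A) (n : ℕ) (f : Vec A (suc n) → Bool) →
                     parity (allVecs xs (suc n)) f ≡ parity xs (λ x → parity (allVecs xs n) (λ v → f (x ∷ v)))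
parity-allVecs-suc xs n f =
  trans (parity-concatMap (λ x → map (x ∷_) (allVecs xs n)) xs f)
        (parity-cong xs (λ x → parity-map (x ∷_) (allVecs xs n) f))

allZip-cong : {R R′ : A → B → Bool} → (∀ a b → R a b ≡ R′ a b) →
              (as : Vec A n) (bs : Vec B n) → allZip R as bs ≡ allZip R′ as bs
allZip-cong R≡R′ []       []       = refl
allZip-cong R≡R′ (a ∷ as) (b ∷ bs) = cong₂ _∧_ (R≡R′ a b) (allZip-cong R≡R′ as bs)

allZip₄ : (S → T → A → B → Bool) → Vec S n → Vec T n → Vec A n → Vec B n → Bool
allZip₄ w []       []       []       []       = true
allZip₄ w (s ∷ σ) (t ∷ τ) (p ∷ P) (q ∷ Q) = w s t p q ∧ allZip₄ w σ τ P Q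

allZip-∧-allZip : (R : A → B → Bool) (M : S → A → Bool) (N : T → B → Bool)
                  (σ : Vec S n) (τ : Vec T n) (P : Vec A n) (Q : Vec B n) →
                  allZip R P Q ∧ (allZip M σ P ∧ allZip N τ Q)
                    ≡ allZip₄ (λ s t p q → R p q ∧ (M s p ∧ N t q)) σ τ P Q
allZip-∧-allZip R M N []      []      []      []      = refl
allZip-∧-allZip R M N (s ∷ σ) (t ∷ τ) (p ∷ P) (q ∷ Q) = begin
  (R p q ∧ allZip R P Q) ∧ ((M s p ∧ allZip M σ P) ∧ (N t q ∧ allZip N τ Q))
    ≡⟨ cong ((R p q ∧ allZip R P Q) ∧_) (∧-interchange (M s p) (allZip M σ P) (N t q) (allZip N τ Q)) ⟩
  (R p q ∧ allZip R P Q) ∧ ((M s p ∧ N t q) ∧ (allZip M σ P ∧ allZip N τ Q))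
    ≡⟨ ∧-interchange (R p q) (allZip R P Q) (M s p ∧ N t q) (allZip M σ P ∧ allZip N τ Q) ⟩
  (R p q ∧ (M s p ∧ N t q)) ∧ (allZip R P Q ∧ (allZip M σ P ∧ allZip N τ Q))
    ≡⟨ cong ((R p q ∧ (M s p ∧ N t q)) ∧_) (allZip-∧-allZip R M N σ τ P Q) ⟩
  (R p q ∧ (M s p ∧ N t q)) ∧ allZip₄ (λ s t p q → R p q ∧ (M s p ∧ N t q)) σ τ P Q ∎
  where open ≡-Reasoning

parity-allVecs-allZip₄ : (xs : List A) (ys : List B) (w : S → T → A → B → Bool)
                         (σ : Vec S n) (τ : Vec T n) →
                         parity (allVecs xs n) (λ P → parity (allVecs ys n) (allZip₄ w σ τ P))
                           ≡ allZip (λ s t → parity xs (λ p → parity ys (w s t p))) σ τ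
parity-allVecs-allZip₄ xs ys w []      []      = refl
parity-allVecs-allZip₄ {n = suc n} xs ys w (s ∷ σ) (t ∷ τ) = begin
  parity (allVecs xs (suc n)) (λ P → parity (allVecs ys (suc n)) (allZip₄ w (s ∷ σ) (t ∷ τ) P))
    ≡⟨ parity-allVecs-suc xs n (λ P → parity (allVecs ys (suc n)) (allZip₄ w (s ∷ σ) (t ∷ τ) P)) ⟩
  parity xs (λ p → parity Ps (λ P → parity (allVecs ys (suc n)) (allZip₄ w (s ∷ σ) (t ∷ τ) (p ∷ P))))
    ≡⟨ parity-cong xs (λ p → parity-cong Ps (λ P → parity-allVecs-suc ys n (allZip₄ w (s ∷ σ) (t ∷ τ) (p ∷ P)))) ⟩
  parity xs (λ p → parity Ps (λ P → parity ys (λ q → parity Qs (λ Q → w s t p q ∧ rest P Q))))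
    ≡⟨ parity-cong xs (λ p → parity-comm Ps ys (λ P q → parity Qs (λ Q → w s t p q ∧ rest P Q))) ⟩
  parity xs (λ p → parity ys (λ q → parity Ps (λ P → parity Qs (λ Q → w s t p q ∧ rest P Q))))
    ≡⟨ parity-cong xs (λ p → parity-cong ys (λ q → factor (w s t p q))) ⟩
  parity xs (λ p → parity ys (λ q → w s t p q ∧ restParity))
    ≡⟨ parity-cong xs (λ p → parity-∧ʳ ys (w s t p) restParity) ⟩
  parity xs (λ p → parity ys (w s t p) ∧ restParity)
    ≡⟨ parity-∧ʳ xs (λ p → parity ys (w s t p)) restParity ⟩
  parity xs (λ p → parity ys (w s t p)) ∧ restParity
    ≡⟨ cong (parity xs (λ p → parity ys (w s t p)) ∧_) (parity-allVecs-allZip₄ xs ys w σ τ) ⟩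
  allZip (λ s t → parity xs (λ p → parity ys (w s t p))) (s ∷ σ) (t ∷ τ) ∎
  where
  open ≡-Reasoning
  Ps = allVecs xs n
  Qs = allVecs ys n
  rest = allZip₄ w σ τ
  restParity = parity Ps (λ P → parity Qs (rest P))
  factor : (c : Bool) → parity Ps (λ P → parity Qs (λ Q → c ∧ rest P Q)) ≡ c ∧ restParity
  factor c = trans (parity-cong Ps (λ P → parity-∧ˡ Qs c (rest P))) (parity-∧ˡ Ps c (λ P → parity Qs (rest P)))

meetsInOne : Subset 3 → Subset 3 → Bool
meetsInOne p q = ⌊ ≡-dec _≟B_ (p ∩ q) ⁅ Fin.zero ⁆ ⌋

_∈ᵇ_ : Fin 3 → Subset 3 → Bool
s ∈ᵇ p = lookup p s

octahedralWeight : Fin 3 → Fin 3 → Subset 3 → Subset 3 → Bool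
octahedralWeight s t p q = meetsInOne p q ∧ (s ∈ᵇ p ∧ t ∈ᵇ q)

parity-octahedralWeight : (s t : Fin 3) →
                          parity twoSubsets (λ p → parity twoSubsets (octahedralWeight s t p)) ≡ not ⌊ s ≟F t ⌋
parity-octahedralWeight Fin.zero                     Fin.zero                     = refl
parity-octahedralWeight Fin.zero                     (Fin.suc Fin.zero)           = refl
parity-octahedralWeight Fin.zero                     (Fin.suc (Fin.suc Fin.zero)) = refl
parity-octahedralWeight (Fin.suc Fin.zero)           Fin.zero                     = refl
parity-octahedralWeight (Fin.suc Fin.zero)           (Fin.suc Fin.zero)           = refl
parity-octahedralWeight (Fin.suc Fin.zero)           (Fin.suc (Fin.suc Fin.zero)) = refl
parity-octahedralWeight (Fin.suc (Fin.suc Fin.zero)) Fin.zero                     = refl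
parity-octahedralWeight (Fin.suc (Fin.suc Fin.zero)) (Fin.suc Fin.zero)           = refl
parity-octahedralWeight (Fin.suc (Fin.suc Fin.zero)) (Fin.suc (Fin.suc Fin.zero)) = refl

lemma2p3 : (k : ℕ) → 1 ≤ k → (στ : Face k × Face k) → disjointPairs k στ ≡ octahedralSum k στ
lemma2p3 k _ (σ , τ) = sym (begin
  octahedralSum k (σ , τ)
    ≡⟨ parity-map product (admissiblePairs k) (λ S → S (σ , τ)) ⟩
  parity (admissiblePairs k) (λ PQ → product PQ (σ , τ))
    ≡⟨ parity-filter (λ PQ → intersectionIsOne (proj₁ PQ) (proj₂ PQ)) (cartesianProduct Os Os) (λ PQ → product PQ (σ , τ)) ⟩
  parity (cartesianProduct Os Os) (λ PQ → intersectionIsOne (proj₁ PQ) (proj₂ PQ) ∧ product PQ (σ , τ))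
    ≡⟨ parity-cartesianProduct Os Os (λ PQ → intersectionIsOne (proj₁ PQ) (proj₂ PQ) ∧ product PQ (σ , τ)) ⟩
  parity Os (λ P → parity Os (λ Q → intersectionIsOne P Q ∧ (faceIn σ P ∧ faceIn τ Q)))
    ≡⟨ parity-cong Os (λ P → parity-cong Os (allZip-∧-allZip meetsInOne _∈ᵇ_ _∈ᵇ_ σ τ P)) ⟩
  parity Os (λ P → parity Os (allZip₄ octahedralWeight σ τ P))
    ≡⟨ parity-allVecs-allZip₄ twoSubsets twoSubsets octahedralWeight σ τ ⟩
  allZip (λ s t → parity twoSubsets (λ p → parity twoSubsets (octahedralWeight s t p))) σ τ
    ≡⟨ allZip-cong parity-octahedralWeight σ τ ⟩
  disjointPairs k (σ , τ) ∎)
  where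
  open ≡-Reasoning
  Os = allOctahedra k
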